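{- Let $A=\{0,a_2,a_3,a_4,a_5\}$ be a set of nonnegative integers with $0<a_2<a_3<a_4<a_5$. Assume that $a_2\not\equiv 0\pmod 2$, $a_3=2a_2$ and $a_4=3a_2$. Then \[ |4^{\wedge}_{\pm}A| = \begin{cases} 21, & \text{if } A=a_2\ast\{0,1,2,3,4\};\\ 23, & \text{if } A=a_2\ast\{0,1,2,3,5\};\\ 25, & \text{if } A=a_2\ast\{0,1,2,3,6\}.\end{cases} \] Otherwise, $|4^{\wedge}_{\pm}A|\geq 22$.
   Context: For a finite set $A=\{a_1,\ldots,a_k\}$ of integers and a positive integer $h$, the restricted $h$-fold signed sumset is $h^{\wedge}_{\pm}A=\left\{\sum_{i=1}^{k}\lambda_i a_i : \lambda_i\in\{ -1,0,1\} \text{ for all } i,\ \sum_{i=1}^{k}|\lambda_i| = h\right\}$. For an integer $c$ and a set $S$ of integers, $c\ast S=\{cs: s\in S\}$. -}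

module Defs where

open import Data.Nat using (ℕ; zero; suc)
open import Data.Integer using (ℤ; _+_; -_; _*_; 0ℤ)
open import Data.Integer.Properties using (_≟_)
open import Data.List using (List; []; _∷_; _++_; map; length; deduplicate)

-- All sums  Σ λᵢ aᵢ  with λᵢ ∈ {-1,0,1} and Σ |λᵢ| = h, listed with repetitions,
-- where the list xs = [a₁, …, a_k] enumerates the set A.
signedSums : ℕ → List ℤ → List ℤ
signedSums zero    _        = 0ℤ ∷ []
signedSums (suc h) []       = []
signedSums (suc h) (a ∷ as) =
  signedSums (suc h) as ++ map (a +_) (signedSums h as) ++ map ((- a) +_) (signedSums h as)

card : List ℤ → ℕ
card xs = length (deduplicate _≟_ xs)

-- | h^∧_± A |  for the finite set A listed (without repetition) by xs.
restrictedSignedSumsetSize : ℕ → List ℤ → ℕ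
restrictedSignedSumsetSize h xs = card (signedSums h xs)

_∗_ : ℤ → List ℤ → List ℤ
c ∗ S = map (c *_) S

-- Dilating A by a nonzero factor preserves |h^∧_± A|, so the three exceptional sets reduce to
-- a₂ = 1, where the sizes are computed. Otherwise A = {0, a, 2a, 3a, b} with b > 3a and b ≠ 4a.
-- Signed 3-sums of {0, 1, 2, 3} cover every k with |k| ≤ 6, so 4^∧_± A contains b + k a
-- (−6 ≤ k ≤ 6) and −b + j a (−6 ≤ j ≤ 2). A coincidence between the two families forces
-- 2b = (j − k) a with 6 < j − k ≤ 8; j − k = 7 makes a even and j − k = 8 gives b = 4a.
-- Hence these 22 sums are distinct.
module Submission where

open import Defs
open import Data.Nat using (_≥_)
open import Data.Integer using (ℤ; +_; _<_; _*_; 0ℤ)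
open import Data.Integer.Divisibility using (_∣_)
open import Data.List using (List; []; _∷_)
open import Data.Product using (_×_)
open import Relation.Binary.PropositionalEquality using (_≡_; _≢_)
open import Relation.Nullary using (¬_)

import Data.Nat as ℕ
import Data.Nat.Divisibility as ℕ
open import Data.Integer using (_+_; -_; _-_; _≤_; NonZero; >-nonZero; NonNegative; nonNegative)
import Data.Integer.Divisibility as ℤ
import Data.Integer.Properties as ℤ
open import Data.Integer.Tactic.RingSolver using (solve-∀)
open import Algebra.Properties.AbelianGroup ℤ.+-0-abelianGroup using (∙-cancelʳ)
open import Data.List using (_++_; map; length; filter; deduplicate)
import Data.List.Properties as List
open import Data.List.Relation.Unary.All as All using (all?)
open import Data.List.Relation.Unary.AllPairs as AllPairs using (allPairs?)
open import Data.List.Relation.Unary.Any using (here; there; _─_)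
open import Data.List.Relation.Unary.Unique.Propositional using (Unique)
import Data.List.Relation.Unary.Unique.Propositional.Properties as Unique
open import Data.List.Membership.Propositional using (_∈_)
open import Data.List.Membership.DecPropositional ℤ._≟_ using (_∈?_)
open import Data.List.Membership.Propositional.Properties
  using (∈-map⁺; ∈-map⁻; ∈-++⁺ˡ; ∈-++⁺ʳ; ∈-++⁻; ∈-deduplicate⁺)
open import Data.List.Relation.Binary.Subset.Propositional using (_⊆_)
open import Data.Product using (_,_)
open import Data.Sum using (_⊎_; inj₁; inj₂)
open import Data.Empty using (⊥-elim)
open import Function using (_∘_; Injective)
open import Relation.Nullary using (yes; no; ¬?)
open import Relation.Nullary.Decidable using (from-yes)
open import Relation.Binary.PropositionalEquality
  using (refl; sym; trans; cong; cong₂; subst; module ≡-Reasoning)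

∈-─⁺ : ∀ {A : Set} {x y : A} {zs} (y∈zs : y ∈ zs) → x ∈ zs → x ≢ y → x ∈ (zs ─ y∈zs)
∈-─⁺ (here refl) (here refl) x≢y = ⊥-elim (x≢y refl)
∈-─⁺ (here refl) (there x∈zs) _ = x∈zs
∈-─⁺ (there _) (here refl) _ = here refl
∈-─⁺ (there y∈zs) (there x∈zs) x≢y = there (∈-─⁺ y∈zs x∈zs x≢y)

unique⊆⇒length≤ : ∀ {A : Set} {ys zs : List A} → Unique ys → ys ⊆ zs → length ys ℕ.≤ length zs
unique⊆⇒length≤ {ys = []} _ _ = ℕ.z≤n
unique⊆⇒length≤ {ys = y ∷ ys} {zs} (y∉ys AllPairs.∷ ys!) ys⊆zs =
  subst (length (y ∷ ys) ℕ.≤_) (sym (List.length-removeAt′ zs _))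
    (ℕ.s≤s (unique⊆⇒length≤ ys! ys⊆zs─y))
  where
  ys⊆zs─y : ys ⊆ (zs ─ ys⊆zs (here refl))
  ys⊆zs─y x∈ys = ∈-─⁺ _ (ys⊆zs (there x∈ys)) (λ x≡y → All.lookup y∉ys x∈ys (sym x≡y))

unique⊆⇒length≤card : ∀ {ys xs} → Unique ys → ys ⊆ xs → length ys ℕ.≤ card xs
unique⊆⇒length≤card ys! ys⊆xs = unique⊆⇒length≤ ys! (∈-deduplicate⁺ ℤ._≟_ ∘ ys⊆xs)

module _ {f : ℤ → ℤ} (f-injective : Injective _≡_ _≡_ f) where

  filter-map-injective : ∀ x xs →
    filter (¬? ∘ (f x ℤ.≟_)) (map f xs) ≡ map f (filter (¬? ∘ (x ℤ.≟_)) xs)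
  filter-map-injective x [] = refl
  filter-map-injective x (y ∷ xs) with x ℤ.≟ y | f x ℤ.≟ f y
  ... | yes _   | yes _    = filter-map-injective x xs
  ... | no _    | no _     = cong (f y ∷_) (filter-map-injective x xs)
  ... | yes x≡y | no fx≢fy = ⊥-elim (fx≢fy (cong f x≡y))
  ... | no x≢y  | yes fx≡fy = ⊥-elim (x≢y (f-injective fx≡fy))

  deduplicate-map-injective : ∀ xs → deduplicate ℤ._≟_ (map f xs) ≡ map f (deduplicate ℤ._≟_ xs)
  deduplicate-map-injective [] = refl
  deduplicate-map-injective (x ∷ xs) = cong (f x ∷_) (begin
    filter (¬? ∘ (f x ℤ.≟_)) (deduplicate ℤ._≟_ (map f xs))
      ≡⟨ cong (filter _) (deduplicate-map-injective xs) ⟩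
    filter (¬? ∘ (f x ℤ.≟_)) (map f (deduplicate ℤ._≟_ xs))
      ≡⟨ filter-map-injective x (deduplicate ℤ._≟_ xs) ⟩
    map f (filter (¬? ∘ (x ℤ.≟_)) (deduplicate ℤ._≟_ xs)) ∎)
    where open ≡-Reasoning

  card-map-injective : ∀ xs → card (map f xs) ≡ card xs
  card-map-injective xs = begin
    length (deduplicate ℤ._≟_ (map f xs)) ≡⟨ cong length (deduplicate-map-injective xs) ⟩
    length (map f (deduplicate ℤ._≟_ xs)) ≡⟨ List.length-map f (deduplicate ℤ._≟_ xs) ⟩
    card xs                               ∎
    where open ≡-Reasoning

signedSums-∗ : ∀ c h xs → signedSums h (c ∗ xs) ≡ c ∗ signedSums h xs
signedSums-∗ c ℕ.zero xs = cong (_∷ []) (sym (ℤ.*-zeroʳ c))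
signedSums-∗ c (ℕ.suc h) [] = refl
signedSums-∗ c (ℕ.suc h) (a ∷ as) = begin
  signedSums (ℕ.suc h) (c ∗ as) ++ map (_+_ (c * a)) (signedSums h (c ∗ as))
                                ++ map (_+_ (- (c * a))) (signedSums h (c ∗ as))
    ≡⟨ cong₂ (λ S₁ S₀ → S₁ ++ map (_+_ (c * a)) S₀ ++ map (_+_ (- (c * a))) S₀)
             (signedSums-∗ c (ℕ.suc h) as) (signedSums-∗ c h as) ⟩
  c ∗ S₁ ++ map (_+_ (c * a)) (c ∗ S₀) ++ map (_+_ (- (c * a))) (c ∗ S₀)
    ≡⟨ cong (λ T → c ∗ S₁ ++ T) (cong₂ _++_ (shift (c * a) a (λ x → sym (ℤ.*-distribˡ-+ c a x)))
                                             (shift (- (c * a)) (- a) distrib-neg)) ⟩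
  c ∗ S₁ ++ c ∗ map (_+_ a) S₀ ++ c ∗ map (_+_ (- a)) S₀
    ≡⟨ cong (c ∗ S₁ ++_) (List.map-++ (c *_) (map (_+_ a) S₀) _) ⟨
  c ∗ S₁ ++ c ∗ (map (_+_ a) S₀ ++ map (_+_ (- a)) S₀)
    ≡⟨ List.map-++ (c *_) S₁ _ ⟨
  c ∗ (S₁ ++ map (_+_ a) S₀ ++ map (_+_ (- a)) S₀) ∎
  where
  open ≡-Reasoning
  S₁ = signedSums (ℕ.suc h) as
  S₀ = signedSums h as
  distrib-neg : ∀ x → - (c * a) + c * x ≡ c * (- a + x)
  distrib-neg x = begin
    - (c * a) + c * x ≡⟨ cong (_+ c * x) (ℤ.neg-distribʳ-* c a) ⟩
    c * - a + c * x   ≡⟨ ℤ.*-distribˡ-+ c (- a) x ⟨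
    c * (- a + x)     ∎
  shift : ∀ ca a′ → (∀ x → ca + c * x ≡ c * (a′ + x)) →
          map (_+_ ca) (c ∗ S₀) ≡ c ∗ map (_+_ a′) S₀
  shift ca a′ eq = begin
    map (_+_ ca) (c ∗ S₀)       ≡⟨ List.map-∘ S₀ ⟨
    map (λ x → ca + c * x) S₀  ≡⟨ List.map-cong eq S₀ ⟩
    map (λ x → c * (a′ + x)) S₀ ≡⟨ List.map-∘ S₀ ⟩
    c ∗ map (_+_ a′) S₀         ∎

card-signedSums-∗ : ∀ c .{{_ : NonZero c}} h xs → card (signedSums h (c ∗ xs)) ≡ card (signedSums h xs)
card-signedSums-∗ c h xs = begin
  card (signedSums h (c ∗ xs)) ≡⟨ cong card (signedSums-∗ c h xs) ⟩
  card (c ∗ signedSums h xs)   ≡⟨ card-map-injective (ℤ.*-cancelˡ-≡ c _ _) (signedSums h xs) ⟩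
  card (signedSums h xs)       ∎
  where open ≡-Reasoning

signedSums-++⁺ʳ : ∀ h xs {ys} → signedSums h ys ⊆ signedSums h (xs ++ ys)
signedSums-++⁺ʳ h [] y∈ = y∈
signedSums-++⁺ʳ ℕ.zero (_ ∷ _) y∈ = y∈
signedSums-++⁺ʳ (ℕ.suc h) (_ ∷ xs) y∈ = ∈-++⁺ˡ (signedSums-++⁺ʳ (ℕ.suc h) xs y∈)

+-∈-signedSums-++ : ∀ i j xs {ys x y} → x ∈ signedSums i xs → y ∈ signedSums j ys →
                    x + y ∈ signedSums (i ℕ.+ j) (xs ++ ys)
+-∈-signedSums-++ ℕ.zero j xs {y = y} (here refl) y∈ =
  subst (_∈ _) (sym (ℤ.+-identityˡ y)) (signedSums-++⁺ʳ j xs y∈)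
+-∈-signedSums-++ (ℕ.suc i) j (a ∷ as) {ys} {y = y} x∈ y∈ with ∈-++⁻ (signedSums (ℕ.suc i) as) x∈
... | inj₁ x∈′ = ∈-++⁺ˡ (+-∈-signedSums-++ (ℕ.suc i) j as x∈′ y∈)
... | inj₂ x∈′ with ∈-++⁻ (map (_+_ a) (signedSums i as)) x∈′
...   | inj₁ x∈₊ with x′ , x′∈ , refl ← ∈-map⁻ (_+_ a) x∈₊ =
  subst (_∈ _) (sym (ℤ.+-assoc a x′ y))
    (∈-++⁺ʳ (signedSums (ℕ.suc (i ℕ.+ j)) (as ++ ys))
      (∈-++⁺ˡ (∈-map⁺ (_+_ a) (+-∈-signedSums-++ i j as x′∈ y∈))))
...   | inj₂ x∈₋ with x′ , x′∈ , refl ← ∈-map⁻ (_+_ (- a)) x∈₋ =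
  subst (_∈ _) (sym (ℤ.+-assoc (- a) x′ y))
    (∈-++⁺ʳ (signedSums (ℕ.suc (i ℕ.+ j)) (as ++ ys))
      (∈-++⁺ʳ (map (_+_ a) (signedSums (i ℕ.+ j) (as ++ ys)))
        (∈-map⁺ (_+_ (- a)) (+-∈-signedSums-++ i j as x′∈ y∈))))

between-6-and-8 : ∀ {d} → + 6 < d → d ≤ + 8 → d ≡ + 7 ⊎ d ≡ + 8
between-6-and-8 {d} 6<d d≤8 with d ℤ.≟ + 8
... | yes d≡8 = inj₂ d≡8
... | no d≢8  =
  inj₁ (ℤ.≤-antisym (ℤ.i<j⇒i≤pred[j] (ℤ.≤∧≢⇒< d≤8 d≢8)) (ℤ.i<j⇒suc[i]≤j 6<d))

double>six-times : ∀ {a b d} → 0ℤ < a → + 3 * a < b → b + b ≡ a * d → + 6 < d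
double>six-times {a} {b} {d} 0<a 3a<b 2b≡ad = ℤ.*-cancelˡ-<-nonNeg a (begin-strict
  a * + 6           ≡⟨ six a ⟩
  + 3 * a + + 3 * a <⟨ ℤ.+-mono-< 3a<b 3a<b ⟩
  b + b             ≡⟨ 2b≡ad ⟩
  a * d             ∎)
  where
  open ℤ.≤-Reasoning
  instance
    a-nonNeg : NonNegative a
    a-nonNeg = nonNegative (ℤ.<⇒≤ 0<a)
  six : ∀ a → a * + 6 ≡ + 3 * a + + 3 * a
  six = solve-∀

double≢multiple : ∀ {a b d} → 0ℤ < a → + 3 * a < b → ¬ (+ 2 ∣ a) → b ≢ + 4 * a →
                  d ≤ + 8 → b + b ≢ a * d
double≢multiple {a} {b} 0<a 3a<b a-odd b≢4a d≤8 2b≡ad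
  with between-6-and-8 (double>six-times 0<a 3a<b 2b≡ad) d≤8
... | inj₁ refl = a-odd (subst (+ 2 ∣_) (sym a≡2[b-3a]) (ℤ.*-monoʳ-∣ (+ 2) {+ 1} {b - + 3 * a} (ℕ.1∣ _)))
  where
  open ≡-Reasoning
  rearrange : ∀ a b → + 2 * (b - + 3 * a) ≡ b + b - a * + 6
  rearrange = solve-∀
  seven-six : ∀ a → a * + 7 - a * + 6 ≡ a
  seven-six = solve-∀
  a≡2[b-3a] : a ≡ + 2 * (b - + 3 * a)
  a≡2[b-3a] = sym (begin
    + 2 * (b - + 3 * a) ≡⟨ rearrange a b ⟩
    b + b - a * + 6     ≡⟨ cong (_- a * + 6) 2b≡ad ⟩
    a * + 7 - a * + 6   ≡⟨ seven-six a ⟩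
    a                   ∎)
... | inj₂ refl = b≢4a (ℤ.*-cancelˡ-≡ (+ 2) b (+ 4 * a) (begin
    + 2 * b         ≡⟨ double b ⟩
    b + b           ≡⟨ 2b≡ad ⟩
    a * + 8         ≡⟨ eight a ⟩
    + 2 * (+ 4 * a) ∎))
  where
  open ≡-Reasoning
  double : ∀ b → + 2 * b ≡ b + b
  double = solve-∀
  eight : ∀ a → a * + 8 ≡ + 2 * (+ 4 * a)
  eight = solve-∀

A[_,_] : ℤ → ℤ → List ℤ
A[ a , b ] = 0ℤ ∷ a ∷ + 2 * a ∷ + 3 * a ∷ b ∷ []

[0‥3] : List ℤ
[0‥3] = + 0 ∷ + 1 ∷ + 2 ∷ + 3 ∷ []

a∗[0‥3]++[b]≡A : ∀ a b → a ∗ [0‥3] ++ b ∷ [] ≡ A[ a , b ]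
a∗[0‥3]++[b]≡A a b =
  cong₂ _∷_ (ℤ.*-zeroʳ a) (cong₂ _∷_ (ℤ.*-identityʳ a)
    (cong₂ _∷_ (ℤ.*-comm a (+ 2)) (cong₂ _∷_ (ℤ.*-comm a (+ 3)) refl)))

module _ {a b : ℤ} (0<a : 0ℤ < a) (3a<b : + 3 * a < b) (a-odd : ¬ (+ 2 ∣ a)) (b≢4a : b ≢ + 4 * a) where

  private
    instance
      a-nonZero : NonZero a
      a-nonZero = >-nonZero 0<a

    T : List ℤ
    T = signedSums 3 [0‥3]

    K₁ K₂ : List ℤ
    K₁ = - + 6 ∷ - + 5 ∷ - + 4 ∷ - + 3 ∷ - + 2 ∷ - + 1 ∷ + 0 ∷
         + 1 ∷ + 2 ∷ + 3 ∷ + 4 ∷ + 5 ∷ + 6 ∷ []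
    -- capping j at 2 keeps every cross difference j − k at most 8
    K₂ = - + 6 ∷ - + 5 ∷ - + 4 ∷ - + 3 ∷ - + 2 ∷ - + 1 ∷ + 0 ∷ + 1 ∷ + 2 ∷ []

    upper lower : ℤ → ℤ
    upper k = a * k + b
    lower k = a * k - b

    *+∈signedSums-A : ∀ {k y} → k ∈ T → y ∈ signedSums 1 (b ∷ []) →
                      a * k + y ∈ signedSums 4 A[ a , b ]
    *+∈signedSums-A {k} {y} k∈T y∈ = subst (λ xs → a * k + y ∈ signedSums 4 xs) (a∗[0‥3]++[b]≡A a b)
      (+-∈-signedSums-++ 3 1 (a ∗ [0‥3]) {b ∷ []} ak∈ y∈)
      where
      ak∈ : a * k ∈ signedSums 3 (a ∗ [0‥3])
      ak∈ = subst (a * k ∈_) (sym (signedSums-∗ a 3 [0‥3])) (∈-map⁺ (a *_) k∈T)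

    ys : List ℤ
    ys = map upper K₁ ++ map lower K₂

    ys⊆ : ys ⊆ signedSums 4 A[ a , b ]
    ys⊆ y∈ys with ∈-++⁻ (map upper K₁) y∈ys
    ... | inj₁ y∈↑ with k , k∈ , refl ← ∈-map⁻ upper y∈↑ =
      *+∈signedSums-A (All.lookup (from-yes (all? (_∈? T) K₁)) k∈) (here (sym (ℤ.+-identityʳ b)))
    ... | inj₂ y∈↓ with k , k∈ , refl ← ∈-map⁻ lower y∈↓ =
      *+∈signedSums-A (All.lookup (from-yes (all? (_∈? T) K₂)) k∈)
                      (there (here (sym (ℤ.+-identityʳ (- b)))))

    upper≢lower : ∀ {k j} → k ∈ K₁ → j ∈ K₂ → upper k ≢ lower j
    upper≢lower {k} {j} k∈ j∈ ak+b≡aj-b = double≢multiple 0<a 3a<b a-odd b≢4a j-k≤8 (begin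
      b + b                 ≡⟨ isolate a b k ⟩
      a * k + b + b - a * k ≡⟨ cong (λ x → x + b - a * k) ak+b≡aj-b ⟩
      a * j - b + b - a * k ≡⟨ collect a b j k ⟩
      a * (j - k)           ∎)
      where
      open ≡-Reasoning
      isolate : ∀ a b k → b + b ≡ a * k + b + b - a * k
      isolate = solve-∀
      collect : ∀ a b j k → a * j - b + b - a * k ≡ a * (j - k)
      collect = solve-∀
      j-k≤8 : j - k ≤ + 8
      j-k≤8 = ℤ.+-mono-≤ (All.lookup (from-yes (all? (ℤ._≤? + 2) K₂)) j∈)
                         (ℤ.neg-mono-≤ (All.lookup (from-yes (all? (- + 6 ℤ.≤?_) K₁)) k∈))

    unique-ys : Unique ys
    unique-ys = Unique.++⁺
      (Unique.map⁺ (ℤ.*-cancelˡ-≡ a _ _ ∘ ∙-cancelʳ b _ _)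
                   (from-yes (allPairs? (λ x y → ¬? (x ℤ.≟ y)) K₁)))
      (Unique.map⁺ (ℤ.*-cancelˡ-≡ a _ _ ∘ ∙-cancelʳ (- b) _ _)
                   (from-yes (allPairs? (λ x y → ¬? (x ℤ.≟ y)) K₂)))
      disjoint
      where
      disjoint : ∀ {y} → ¬ (y ∈ map upper K₁ × y ∈ map lower K₂)
      disjoint (y∈↑ , y∈↓)
        with k , k∈ , refl ← ∈-map⁻ upper y∈↑ | j , j∈ , eq ← ∈-map⁻ lower y∈↓ =
        upper≢lower k∈ j∈ eq

  card-signedSums-A≥22 : card (signedSums 4 A[ a , b ]) ≥ 22
  card-signedSums-A≥22 = unique⊆⇒length≤card unique-ys ys⊆

lemma2p13 : (a₂ a₃ a₄ a₅ : ℤ) → 0ℤ < a₂ → a₂ < a₃ → a₃ < a₄ → a₄ < a₅ →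
    ¬ (+ 2 ∣ a₂) → a₃ ≡ + 2 * a₂ → a₄ ≡ + 3 * a₂ →
    let A = 0ℤ ∷ a₂ ∷ a₃ ∷ a₄ ∷ a₅ ∷ [] in
    let S = restrictedSignedSumsetSize 4 A in
    (A ≡ a₂ ∗ (+ 0 ∷ + 1 ∷ + 2 ∷ + 3 ∷ + 4 ∷ []) → S ≡ 21) ×
    (A ≡ a₂ ∗ (+ 0 ∷ + 1 ∷ + 2 ∷ + 3 ∷ + 5 ∷ []) → S ≡ 23) ×
    (A ≡ a₂ ∗ (+ 0 ∷ + 1 ∷ + 2 ∷ + 3 ∷ + 6 ∷ []) → S ≡ 25) ×
    (A ≢ a₂ ∗ (+ 0 ∷ + 1 ∷ + 2 ∷ + 3 ∷ + 4 ∷ []) →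
     A ≢ a₂ ∗ (+ 0 ∷ + 1 ∷ + 2 ∷ + 3 ∷ + 5 ∷ []) →
     A ≢ a₂ ∗ (+ 0 ∷ + 1 ∷ + 2 ∷ + 3 ∷ + 6 ∷ []) → S ≥ 22)
lemma2p13 a .(+ 2 * a) .(+ 3 * a) b 0<a _ _ 3a<b a-odd refl refl =
  size-of-multiple (+ 4) refl ,
  size-of-multiple (+ 5) refl ,
  size-of-multiple (+ 6) refl ,
  λ A≢a∗[0‥4] _ _ → card-signedSums-A≥22 0<a 3a<b a-odd (A≢a∗[0‥4] ∘ A≡a∗[0‥4])
  where
  instance
    a-nonZero : NonZero a
    a-nonZero = >-nonZero 0<a
  size-of-multiple : ∀ m {n} → card (signedSums 4 ([0‥3] ++ m ∷ [])) ≡ n →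
                     A[ a , b ] ≡ a ∗ ([0‥3] ++ m ∷ []) → card (signedSums 4 A[ a , b ]) ≡ n
  size-of-multiple m size A≡a∗ =
    trans (cong (card ∘ signedSums 4) A≡a∗) (trans (card-signedSums-∗ a 4 ([0‥3] ++ m ∷ [])) size)
  A≡a∗[0‥4] : b ≡ + 4 * a → A[ a , b ] ≡ a ∗ ([0‥3] ++ + 4 ∷ [])
  A≡a∗[0‥4] refl =
    trans (sym (a∗[0‥3]++[b]≡A a (+ 4 * a))) (cong (λ x → a ∗ [0‥3] ++ x ∷ []) (ℤ.*-comm (+ 4) a))
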